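{- Let $F$ be a connected graph and $Q$ be a connected chordal graph. Let $\mu:V(F)\rightarrow V(Q)$ be a function such that for every induced path $p_1\cdots p_m$ in $F$ of length at most two, the vertices $\mu(p_1),\ldots,\mu(p_m)$ are pairwise distinct and $\mu(p_1)\cdots\mu(p_m)$ is an induced path of $Q$. Then $\mu$ is injective and for all $v,w\in V(F)$, $vw\in E(F)$ if and only if $\mu(v)\mu(w)\in E(Q)$.
   Context: The length of a path is its number of edges (so paths of length at most two have $m\in\{1,2,3\}$ vertices). A graph is chordal if it has no induced cycle of length at least $4$. -}

module Defs where

open import Level using (0ℓ)
open import Data.Nat using (ℕ; zero; suc; _≤_)
open import Data.Fin using (Fin; toℕ)
open import Data.Product using (_×_; ∃)
open import Data.Sum using (_⊎_)
open import Relation.Nullary using (¬_; Dec)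
open import Relation.Binary.PropositionalEquality using (_≡_)
open import Function.Definitions using (Injective)
open import Function.Bundles using (_⇔_)

record Graph (n : ℕ) : Set₁ where
  field
    Adj     : Fin n → Fin n → Set
    sym     : ∀ {u v} → Adj u v → Adj v u
    irrefl  : ∀ {u} → ¬ Adj u u
    adj?    : ∀ u v → Dec (Adj u v)
open Graph public

data Walk {n : ℕ} (G : Graph n) : Fin n → Fin n → Set where
  [] : ∀ {u} → Walk G u u
  _∷_ : ∀ {u v w} → Adj G u v → Walk G v w → Walk G u w

Connected : ∀ {n} → Graph n → Set
Connected G = ∀ u v → Walk G u v

PathAdj : ∀ {m} → Fin m → Fin m → Set
PathAdj i j = suc (toℕ i) ≡ toℕ j ⊎ suc (toℕ j) ≡ toℕ i

CycleAdj : ∀ {k} → Fin k → Fin k → Set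
CycleAdj {k} i j =
  PathAdj i j ⊎ ((toℕ i ≡ 0 × suc (toℕ j) ≡ k) ⊎ (toℕ j ≡ 0 × suc (toℕ i) ≡ k))

-- p : Fin m → V(G) lists the vertices p₀ ⋯ p_{m-1} of an induced path
-- (with m vertices, i.e. of length m - 1): pairwise distinct, and
-- p_i p_j is an edge iff |i - j| = 1.
IsInducedPath : ∀ {n m} → Graph n → (Fin m → Fin n) → Set
IsInducedPath G p =
  Injective _≡_ _≡_ p × (∀ i j → Adj G (p i) (p j) ⇔ PathAdj i j)

IsInducedCycle : ∀ {n k} → Graph n → (Fin k → Fin n) → Set
IsInducedCycle G c =
  Injective _≡_ _≡_ c × (∀ i j → Adj G (c i) (c j) ⇔ CycleAdj i j)

Chordal : ∀ {n} → Graph n → Set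
Chordal {n} G = ∀ k → 4 ≤ k → (c : Fin k → Fin n) → ¬ IsInducedCycle G c

module Submission where

-- Call a vertex sequence q₀ ⋯ q_k locally induced if consecutive vertices are
-- adjacent and any three consecutive ones form an induced path
-- (q_i ≠ q_{i+2} and q_i q_{i+2} ∉ E).  The proof combines three facts.
--  1. Shortcutting every non-induced bend turns any walk into a locally
--     induced walk with the same ends; so in a connected graph any two
--     vertices are joined by a locally induced walk.
--  2. μ maps locally induced sequences of F to locally induced sequences of Q.
--  3. In a chordal graph the ends of a locally induced sequence q₀ ⋯ q_k are
--     related like the ends of an induced path of length k: q₀ ≠ q_k if k > 0,
--     and q₀ q_k ∈ E only if k = 1.  By strong induction on k: all proper
--     windows are then induced paths, so for k ≥ 3 an edge q₀ q_k would close
--     an induced cycle q₀ ⋯ q_k of length k + 1 ≥ 4.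
-- If μ(v) = μ(w) or μ(v)μ(w) ∈ E(Q), the image of a locally induced walk from
-- v to w forces it to have length 0 resp. 1, i.e. v = w resp. vw ∈ E(F).
-- Edges are preserved directly, being induced paths with two vertices.

open import Defs hiding (sym)
open import Data.Nat using (ℕ; zero; suc; _+_; _∸_; _≤_; _<_; z≤n; s≤s; z<s)
open import Data.Nat.Properties
open import Data.Nat.Induction using (<-rec)
open import Data.Fin using (Fin; toℕ)
open import Data.Fin.Patterns using (0F; 1F; 2F)
open import Data.Fin.Properties using (toℕ-injective; toℕ<n)
open import Data.Product using (Σ; _×_; _,_; proj₁; proj₂)
open import Data.Sum using (_⊎_; inj₁; inj₂)
open import Data.Unit using (⊤)
open import Data.Empty using (⊥-elim)
open import Relation.Nullary using (¬_; yes; no)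
open import Relation.Binary using (tri<; tri≈; tri>)
open import Relation.Binary.PropositionalEquality
  using (_≡_; _≢_; refl; sym; trans; cong; subst; subst₂)
open import Function using (_∘_)
open import Function.Definitions using (Injective)
open import Function.Bundles using (_⇔_; mk⇔; Equivalence)
open import Function.Properties.Equivalence using ()
  renaming (sym to ⇔-sym; trans to ⇔-trans)
import Data.Fin as Fin

⇔-both : ∀ {A B : Set} → A → B → A ⇔ B
⇔-both a b = mk⇔ (λ _ → b) (λ _ → a)

⇔-neither : ∀ {A B : Set} → ¬ A → ¬ B → A ⇔ B
⇔-neither ¬a ¬b = mk⇔ (⊥-elim ∘ ¬a) (⊥-elim ∘ ¬b)

adj⇒≢ : ∀ {n} (G : Graph n) {x y} → Adj G x y → x ≢ y
adj⇒≢ G xy refl = irrefl G xy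

adj-comm : ∀ {n} (G : Graph n) {x y} → Adj G x y ⇔ Adj G y x
adj-comm G = mk⇔ (Graph.sym G) (Graph.sym G)

pathAdj-irrefl : ∀ {m} (i : Fin m) → ¬ PathAdj i i
pathAdj-irrefl i (inj₁ e) = 1+n≢n e
pathAdj-irrefl i (inj₂ e) = 1+n≢n e

path₂ : ∀ {n} → Fin n → Fin n → Fin 2 → Fin n
path₂ a b 0F = a
path₂ a b 1F = b

path₃ : ∀ {n} → Fin n → Fin n → Fin n → Fin 3 → Fin n
path₃ a b c 0F = a
path₃ a b c 1F = b
path₃ a b c 2F = c

ends-not-pathAdj : ¬ PathAdj {3} 0F 2F
ends-not-pathAdj (inj₁ ())
ends-not-pathAdj (inj₂ ())

module _ {n} (G : Graph n) where

  edge⇒inducedPath : ∀ {a b} → Adj G a b → IsInducedPath G (path₂ a b)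
  edge⇒inducedPath {a} {b} ab = injective , adjacency
    where
      injective : Injective _≡_ _≡_ (path₂ a b)
      injective {0F} {0F} _ = refl
      injective {0F} {1F} a≡b = ⊥-elim (adj⇒≢ G ab a≡b)
      injective {1F} {0F} b≡a = ⊥-elim (adj⇒≢ G ab (sym b≡a))
      injective {1F} {1F} _ = refl

      adjacency : ∀ i j → Adj G (path₂ a b i) (path₂ a b j) ⇔ PathAdj i j
      adjacency 0F 0F = ⇔-neither (irrefl G) (pathAdj-irrefl {2} 0F)
      adjacency 0F 1F = ⇔-both ab (inj₁ refl)
      adjacency 1F 0F = ⇔-both (Graph.sym G ab) (inj₂ refl)
      adjacency 1F 1F = ⇔-neither (irrefl G) (pathAdj-irrefl {2} 1F)

  bend⇒inducedPath : ∀ {a b c} → Adj G a b → Adj G b c → a ≢ c → ¬ Adj G a c →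
                     IsInducedPath G (path₃ a b c)
  bend⇒inducedPath {a} {b} {c} ab bc a≢c a≁c = injective , adjacency
    where
      injective : Injective _≡_ _≡_ (path₃ a b c)
      injective {0F} {0F} _ = refl
      injective {0F} {1F} e = ⊥-elim (adj⇒≢ G ab e)
      injective {0F} {2F} e = ⊥-elim (a≢c e)
      injective {1F} {0F} e = ⊥-elim (adj⇒≢ G ab (sym e))
      injective {1F} {1F} _ = refl
      injective {1F} {2F} e = ⊥-elim (adj⇒≢ G bc e)
      injective {2F} {0F} e = ⊥-elim (a≢c (sym e))
      injective {2F} {1F} e = ⊥-elim (adj⇒≢ G bc (sym e))
      injective {2F} {2F} _ = refl

      adjacency : ∀ i j → Adj G (path₃ a b c i) (path₃ a b c j) ⇔ PathAdj i j
      adjacency 0F 0F = ⇔-neither (irrefl G) (pathAdj-irrefl {3} 0F)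
      adjacency 0F 1F = ⇔-both ab (inj₁ refl)
      adjacency 0F 2F = ⇔-neither a≁c ends-not-pathAdj
      adjacency 1F 0F = ⇔-both (Graph.sym G ab) (inj₂ refl)
      adjacency 1F 1F = ⇔-neither (irrefl G) (pathAdj-irrefl {3} 1F)
      adjacency 1F 2F = ⇔-both bc (inj₁ refl)
      adjacency 2F 0F = ⇔-neither (a≁c ∘ Graph.sym G) (ends-not-pathAdj ∘ swap)
        where
          swap : PathAdj {3} 2F 0F → PathAdj {3} 0F 2F
          swap (inj₁ e) = inj₂ e
          swap (inj₂ e) = inj₁ e
      adjacency 2F 1F = ⇔-both (Graph.sym G bc) (inj₂ refl)
      adjacency 2F 2F = ⇔-neither (irrefl G) (pathAdj-irrefl {3} 2F)

record LocallyInduced {n} (G : Graph n) (q : ℕ → Fin n) (k : ℕ) : Set where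
  field
    step : ∀ i → suc i ≤ k → Adj G (q i) (q (suc i))
    bend : ∀ i → 2 + i ≤ k → q i ≢ q (2 + i) × ¬ Adj G (q i) (q (2 + i))

PathEnds : ∀ {n} → Graph n → ℕ → Fin n → Fin n → Set
PathEnds G l x y = (0 < l → x ≢ y) × (Adj G x y → l ≡ 1)

window : ∀ {n} {G : Graph n} {q k} a l → a + l ≤ k → LocallyInduced G q k →
         LocallyInduced G (λ i → q (a + i)) l
window {G = G} {q} {k} a l a+l≤k li = record { step = step′ ; bend = bend′ }
  where
    open LocallyInduced li

    inside : ∀ {j} → j ≤ l → a + j ≤ k
    inside j≤l = ≤-trans (+-monoʳ-≤ a j≤l) a+l≤k

    shift₂ : ∀ i → a + (2 + i) ≡ 2 + (a + i)
    shift₂ i = trans (+-suc a (suc i)) (cong suc (+-suc a i))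

    step′ : ∀ i → suc i ≤ l → Adj G (q (a + i)) (q (a + suc i))
    step′ i i<l rewrite +-suc a i = step (a + i) (subst (_≤ k) (+-suc a i) (inside i<l))

    bend′ : ∀ i → 2 + i ≤ l →
            q (a + i) ≢ q (a + (2 + i)) × ¬ Adj G (q (a + i)) (q (a + (2 + i)))
    bend′ i i+2≤l rewrite shift₂ i = bend (a + i) (subst (_≤ k) (shift₂ i) (inside i+2≤l))

-- Cyclic adjacency of indices a, b in a cycle with K vertices; for a = toℕ i
-- and b = toℕ j this is CycleAdj {K} i j by definition.
CycleAdjℕ : ℕ → ℕ → ℕ → Set
CycleAdjℕ K a b = (suc a ≡ b ⊎ suc b ≡ a) ⊎ ((a ≡ 0 × suc b ≡ K) ⊎ (b ≡ 0 × suc a ≡ K))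

cycleAdj-comm : ∀ {K a b} → CycleAdjℕ K a b ⇔ CycleAdjℕ K b a
cycleAdj-comm = mk⇔ swap swap
  where
    swap : ∀ {K a b} → CycleAdjℕ K a b → CycleAdjℕ K b a
    swap (inj₁ (inj₁ e)) = inj₁ (inj₂ e)
    swap (inj₁ (inj₂ e)) = inj₁ (inj₁ e)
    swap (inj₂ (inj₁ e)) = inj₂ (inj₂ e)
    swap (inj₂ (inj₂ e)) = inj₂ (inj₁ e)

cycleAdj-irrefl : ∀ {s a} → ¬ CycleAdjℕ (suc (suc s)) a a
cycleAdj-irrefl (inj₁ (inj₁ e)) = 1+n≢n e
cycleAdj-irrefl (inj₁ (inj₂ e)) = 1+n≢n e
cycleAdj-irrefl (inj₂ (inj₁ (refl , ())))
cycleAdj-irrefl (inj₂ (inj₂ (refl , ())))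

cycleAdj-ordered : ∀ {S a b} → a < b →
                   CycleAdjℕ (suc S) a b ⇔ (suc a ≡ b ⊎ (a ≡ 0 × b ≡ S))
cycleAdj-ordered {S} {a} {b} a<b = mk⇔ to from
  where
    to : CycleAdjℕ (suc S) a b → suc a ≡ b ⊎ (a ≡ 0 × b ≡ S)
    to (inj₁ (inj₁ e)) = inj₁ e
    to (inj₁ (inj₂ e)) = ⊥-elim (<-asym a<b (≤-reflexive e))
    to (inj₂ (inj₁ (a≡0 , e))) = inj₂ (a≡0 , suc-injective e)
    to (inj₂ (inj₂ (refl , _))) = ⊥-elim (n≮0 a<b)

    from : suc a ≡ b ⊎ (a ≡ 0 × b ≡ S) → CycleAdjℕ (suc S) a b
    from (inj₁ e) = inj₁ (inj₁ e)
    from (inj₂ (a≡0 , b≡S)) = inj₂ (inj₁ (a≡0 , cong suc b≡S))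

orderedCycle : ∀ {n} (G : Graph n) s (c : ℕ → Fin n) →
  (∀ {a b} → a < b → b ≤ suc s →
     c a ≢ c b × (Adj G (c a) (c b) ⇔ (suc a ≡ b ⊎ (a ≡ 0 × b ≡ suc s)))) →
  IsInducedCycle G (λ (t : Fin (suc (suc s))) → c (toℕ t))
orderedCycle G s c ordered = injective , adjacency
  where
    pair : ∀ (i j : Fin (suc (suc s))) → toℕ i < toℕ j →
           c (toℕ i) ≢ c (toℕ j) × (Adj G (c (toℕ i)) (c (toℕ j)) ⇔ CycleAdj i j)
    pair i j i<j with ordered i<j (≤-pred (toℕ<n j))
    ... | distinct , adjacent = distinct , ⇔-trans adjacent (⇔-sym (cycleAdj-ordered i<j))

    injective : Injective _≡_ _≡_ (λ (t : Fin (suc (suc s))) → c (toℕ t))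
    injective {i} {j} e with <-cmp (toℕ i) (toℕ j)
    ... | tri< i<j _ _ = ⊥-elim (proj₁ (pair i j i<j) e)
    ... | tri≈ _ i≡j _ = toℕ-injective i≡j
    ... | tri> _ _ j<i = ⊥-elim (proj₁ (pair j i j<i) (sym e))

    adjacency : ∀ i j → Adj G (c (toℕ i)) (c (toℕ j)) ⇔ CycleAdj i j
    adjacency i j with <-cmp (toℕ i) (toℕ j)
    ... | tri< i<j _ _ = proj₂ (pair i j i<j)
    ... | tri> _ _ j<i = ⇔-trans (adj-comm G) (⇔-trans (proj₂ (pair j i j<i)) cycleAdj-comm)
    ... | tri≈ _ i≡j _ =
      subst (λ b → Adj G (c (toℕ i)) (c b) ⇔ CycleAdjℕ (suc (suc s)) (toℕ i) b) i≡j
            (⇔-neither (irrefl G) cycleAdj-irrefl)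

proper-or-ends : ∀ {a b k} → a < b → b ≤ k → b ∸ a < k ⊎ (a ≡ 0 × b ≡ k)
proper-or-ends {zero} _ b≤k with m≤n⇒m<n∨m≡n b≤k
... | inj₁ b<k = inj₁ b<k
... | inj₂ b≡k = inj₂ (refl , b≡k)
proper-or-ends {suc a} {b} a<b b≤k = inj₁ (≤-trans (∸-monoʳ-< {b} {suc a} {0} z<s (<⇒≤ a<b)) b≤k)

module _ {n} {G : Graph n} (chordal : Chordal G) where

  ShorterEnds : ℕ → Set
  ShorterEnds k = ∀ {j} → j < k → ∀ {q} → LocallyInduced G q j → PathEnds G j (q 0) (q j)

  long-pathEnds : ∀ s → 2 ≤ s → ShorterEnds (suc s) →
                  ∀ {q} → LocallyInduced G q (suc s) → PathEnds G (suc s) (q 0) (q (suc s))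
  long-pathEnds s 2≤s shorter {q} li = distinct , λ adj → ⊥-elim (no-chord adj)
    where
      open LocallyInduced li

      -- A pair a < b spanning fewer than s + 1 steps bounds a shorter window
      -- q_a ⋯ q_b, so q_a, q_b are related like the ends of an induced path.
      proper-pair : ∀ {a b} → a < b → b ∸ a < suc s → b ≤ suc s →
                    q a ≢ q b × (Adj G (q a) (q b) → suc a ≡ b)
      proper-pair {a} {b} a<b proper b≤k = proj₁ ends (m<n⇒0<n∸m a<b) , consecutive
        where
          a+l≡b : a + (b ∸ a) ≡ b
          a+l≡b = m+[n∸m]≡n (<⇒≤ a<b)

          ends : PathEnds G (b ∸ a) (q a) (q b)
          ends = subst₂ (PathEnds G (b ∸ a)) (cong q (+-identityʳ a)) (cong q a+l≡b)
                   (shorter proper (window a (b ∸ a) (subst (_≤ suc s) (sym a+l≡b) b≤k) li))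

          consecutive : Adj G (q a) (q b) → suc a ≡ b
          consecutive adj = trans (+-comm 1 a) (trans (cong (a +_) (sym (proj₂ ends adj))) a+l≡b)

      -- q₀ = q_{s+1} would make the edge q_s q_{s+1} a chord q_s q₀ of the
      -- shorter window q₀ ⋯ q_s.
      distinct : 0 < suc s → q 0 ≢ q (suc s)
      distinct _ q₀≡qₖ = <⇒≢ 2≤s (sym (proj₂ prefix chord))
        where
          prefix : PathEnds G s (q 0) (q s)
          prefix = shorter ≤-refl (window 0 s (n≤1+n s) li)

          chord : Adj G (q 0) (q s)
          chord = Graph.sym G (subst (Adj G (q s)) (sym q₀≡qₖ) (step s ≤-refl))

      -- An edge q₀ q_{s+1} closes the induced cycle q₀ ⋯ q_{s+1} of length ≥ 4.
      no-chord : ¬ Adj G (q 0) (q (suc s))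
      no-chord adj = chordal (suc (suc s)) (s≤s (s≤s 2≤s)) _ (orderedCycle G s q ordered)
        where
          edge : ∀ {a b} → b ≤ suc s → suc a ≡ b ⊎ (a ≡ 0 × b ≡ suc s) → Adj G (q a) (q b)
          edge b≤k (inj₁ refl) = step _ b≤k
          edge _ (inj₂ (refl , refl)) = adj

          ordered : ∀ {a b} → a < b → b ≤ suc s →
                    q a ≢ q b × (Adj G (q a) (q b) ⇔ (suc a ≡ b ⊎ (a ≡ 0 × b ≡ suc s)))
          ordered a<b b≤k with proper-or-ends a<b b≤k
          ... | inj₁ proper =
            proj₁ (proper-pair a<b proper b≤k) ,
            mk⇔ (inj₁ ∘ proj₂ (proper-pair a<b proper b≤k)) (edge b≤k)
          ... | inj₂ (refl , refl) = distinct z<s , mk⇔ (λ _ → inj₂ (refl , refl)) (edge b≤k)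

  locallyInduced⇒pathEnds : ∀ k {q} → LocallyInduced G q k → PathEnds G k (q 0) (q k)
  locallyInduced⇒pathEnds = <-rec Claim ends
    where
      Claim : ℕ → Set
      Claim k = ∀ {q} → LocallyInduced G q k → PathEnds G k (q 0) (q k)

      ends : ∀ k → ShorterEnds k → Claim k
      ends 0 _ li = (λ ()) , λ adj → ⊥-elim (irrefl G adj)
      ends 1 _ li = (λ _ → adj⇒≢ G (LocallyInduced.step li 0 ≤-refl)) , λ _ → refl
      ends 2 _ {q} li = (λ _ → proj₁ sides) , λ adj → ⊥-elim (proj₂ sides adj)
        where
          sides : q 0 ≢ q 2 × ¬ Adj G (q 0) (q 2)
          sides = LocallyInduced.bend li 0 ≤-refl
      ends (suc s@(suc (suc _))) shorter = long-pathEnds s (s≤s (s≤s z≤n)) shorter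

module Walks {n} (G : Graph n) where

  Reduced : ∀ {u v} → Walk G u v → Set
  Reduced [] = ⊤
  Reduced (_ ∷ []) = ⊤
  Reduced (_∷_ {u = u} _ (_∷_ {v = w} e W)) = (u ≢ w × ¬ Adj G u w) × Reduced (e ∷ W)

  ReducedWalk : Fin n → Fin n → Set
  ReducedWalk u v = Σ (Walk G u v) Reduced

  reduced-tail : ∀ {x y z} {e : Adj G x y} (W : Walk G y z) → Reduced (e ∷ W) → Reduced W
  reduced-tail [] _ = _
  reduced-tail (_ ∷ _) (_ , reduced) = reduced

  prepend : ∀ {u v t} → Adj G u v → (W : Walk G v t) → Reduced W → ReducedWalk u t
  prepend uv [] _ = uv ∷ [] , _
  prepend {u} uv (_∷_ {v = w} vw W) reduced with u Fin.≟ w | adj? G u w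
  ... | yes refl | _ = W , reduced-tail W reduced
  ... | no u≢w | yes uw = prepend uw W (reduced-tail W reduced)
  ... | no u≢w | no u≁w = uv ∷ (vw ∷ W) , (u≢w , u≁w) , reduced

  reduce : ∀ {u v} → Walk G u v → ReducedWalk u v
  reduce [] = [] , _
  reduce (e ∷ W) = let (W′ , reduced) = reduce W in prepend e W′ reduced

  length : ∀ {u v} → Walk G u v → ℕ
  length [] = 0
  length (_ ∷ W) = suc (length W)

  -- The i-th vertex of a walk (its last vertex for i beyond its length).
  vertex : ∀ {u v} → Walk G u v → ℕ → Fin n
  vertex {u} _ zero = u
  vertex {u} [] (suc _) = u
  vertex (_ ∷ W) (suc i) = vertex W i

  vertex-end : ∀ {u v} (W : Walk G u v) → vertex W (length W) ≡ v
  vertex-end [] = refl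
  vertex-end (_ ∷ W) = vertex-end W

  reduced⇒locallyInduced : ∀ {u v} (W : Walk G u v) → Reduced W →
                           LocallyInduced G (vertex W) (length W)
  reduced⇒locallyInduced W reduced = record { step = step W ; bend = bend W reduced }
    where
      step : ∀ {u v} (W : Walk G u v) i → suc i ≤ length W →
             Adj G (vertex W i) (vertex W (suc i))
      step (e ∷ _) zero _ = e
      step (_ ∷ W) (suc i) (s≤s i<l) = step W i i<l

      bend : ∀ {u v} (W : Walk G u v) → Reduced W → ∀ i → 2 + i ≤ length W →
             vertex W i ≢ vertex W (2 + i) × ¬ Adj G (vertex W i) (vertex W (2 + i))
      bend (_ ∷ (_ ∷ _)) (induced , _) zero _ = induced
      bend (_ ∷ []) _ (suc i) (s≤s ())
      bend (_ ∷ (e ∷ W)) (_ , reduced) (suc i) (s≤s le) = bend (e ∷ W) reduced i le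

  walk-with-pathEnds : ∀ {m} {H : Graph m} {x y} {v w} (W : Walk G v w) →
                       PathEnds H (length W) x y → (x ≡ y → v ≡ w) × (Adj H x y → Adj G v w)
  walk-with-pathEnds [] (_ , one) = (λ _ → refl) , λ xy → ⊥-elim (0≢1+n (one xy))
  walk-with-pathEnds (e ∷ []) (distinct , _) = (λ x≡y → ⊥-elim (distinct z<s x≡y)) , λ _ → e
  walk-with-pathEnds (_ ∷ (_ ∷ _)) (distinct , one) =
    (λ x≡y → ⊥-elim (distinct z<s x≡y)) , λ xy → ⊥-elim (0≢1+n (sym (suc-injective (one xy))))

module ShortInducedPaths {nF nQ} {F : Graph nF} {Q : Graph nQ} {μ : Fin nF → Fin nQ}
  (short : ∀ m → 1 ≤ m → m ≤ 3 → (p : Fin m → Fin nF) → IsInducedPath F p →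
     Injective _≡_ _≡_ (μ ∘ p) × IsInducedPath Q (μ ∘ p)) where

  preserves-edge : ∀ {a b} → Adj F a b → Adj Q (μ a) (μ b)
  preserves-edge {a} {b} ab =
    Equivalence.from (proj₂ (proj₂ image) 0F 1F) (inj₁ refl)
    where
      image : Injective _≡_ _≡_ (μ ∘ path₂ a b) × IsInducedPath Q (μ ∘ path₂ a b)
      image = short 2 (s≤s z≤n) (s≤s (s≤s z≤n)) (path₂ a b) (edge⇒inducedPath F ab)

  preserves-bend : ∀ {a b c} → Adj F a b → Adj F b c → a ≢ c → ¬ Adj F a c →
                   μ a ≢ μ c × ¬ Adj Q (μ a) (μ c)
  preserves-bend {a} {b} {c} ab bc a≢c a≁c =
    (λ μa≡μc → 0F≢2F (proj₁ image μa≡μc)) ,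
    (λ adj → ends-not-pathAdj (Equivalence.to (proj₂ (proj₂ image) 0F 2F) adj))
    where
      image : Injective _≡_ _≡_ (μ ∘ path₃ a b c) × IsInducedPath Q (μ ∘ path₃ a b c)
      image = short 3 (s≤s z≤n) ≤-refl (path₃ a b c) (bend⇒inducedPath F ab bc a≢c a≁c)

      0F≢2F : ¬ (_≡_ {A = Fin 3} 0F 2F)
      0F≢2F ()

  preserves-locallyInduced : ∀ {p k} → LocallyInduced F p k → LocallyInduced Q (μ ∘ p) k
  preserves-locallyInduced li = record
    { step = λ i i<k → preserves-edge (step i i<k)
    ; bend = λ i le → preserves-bend (step i (≤-trans (n≤1+n _) le)) (step (suc i) le)
                                     (proj₁ (bend i le)) (proj₂ (bend i le))
    }
    where open LocallyInduced li

lemma3p2 : ∀ {nF nQ} (F : Graph nF) (Q : Graph nQ) →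
    Connected F → Connected Q → Chordal Q →
    (μ : Fin nF → Fin nQ) →
    (∀ m → 1 ≤ m → m ≤ 3 → (p : Fin m → Fin nF) → IsInducedPath F p →
      Injective _≡_ _≡_ (μ ∘ p) × IsInducedPath Q (μ ∘ p)) →
    Injective _≡_ _≡_ μ × (∀ v w → Adj F v w ⇔ Adj Q (μ v) (μ w))
lemma3p2 F Q connected _ chordal μ short =
  (λ {v} {w} → proj₁ (reflects v w)) , λ v w → mk⇔ preserves-edge (proj₂ (reflects v w))
  where
    open ShortInducedPaths {F = F} {Q} {μ} short
    open Walks F

    reflects : ∀ v w → (μ v ≡ μ w → v ≡ w) × (Adj Q (μ v) (μ w) → Adj F v w)
    reflects v w with reduce (connected v w)
    ... | W , reduced = walk-with-pathEnds {H = Q} W imageEnds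
      where
        imageEnds : PathEnds Q (length W) (μ v) (μ w)
        imageEnds = subst (PathEnds Q (length W) (μ v)) (cong μ (vertex-end W))
          (locallyInduced⇒pathEnds chordal (length W)
            (preserves-locallyInduced (reduced⇒locallyInduced W reduced)))
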